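{- Fix an integer $k\geq 1$. Let $\mathbb{F}=\mathbb{C}(x_0,\ldots,x_{2k},a)$ and define $x_n\in\mathbb{F}$ ($n\in\mathbb{Z}$) by iterating $x_{n+2k+1}x_n=x_{n+2k}x_{n+1}+a(x_{n+k}+x_{n+k+1})$ forwards and backwards from $x_0,\ldots,x_{2k}$. Set $F^{(1)}_{2k}=0$ and for $1\le j\le k$ define $$F^{(1)}_{2k+j}=x_j\sum_{\ell=1}^j\frac{x_{k+\ell-1}+x_{k+\ell}}{x_{\ell-1}x_\ell},$$ $$F^{(1)}_{3k+j}=\frac{x_{k+j}x_{2k}}{x_0}\sum_{\ell=1}^j\frac{x_{\ell-1}+x_\ell}{x_{k+\ell-1}x_{k+\ell}}+\frac{x_{k+j}}{x_k}F^{(1)}_{3k},$$ $$F^{(2)}_{3k+j}=x_{k+j}\sum_{\ell=1}^j\frac{F^{(1)}_{2k+\ell-1}+F^{(1)}_{2k+\ell}}{x_{k+\ell-1}x_{k+\ell}}$$ (where $F^{(1)}_{3k}=F^{(1)}_{2k+k}$ is given by the first formula). Then for $1\le j\le k$: $$x_{2k+j}=\frac{x_jx_{2k}}{x_0}+aF^{(1)}_{2k+j},\qquad x_{3k+j}=\frac{x_{k+j}x_{2k}}{x_0}+aF^{(1)}_{3k+j}+a^2F^{(2)}_{3k+j},$$ $$x_{ -j}=\frac{x_{2k-j}x_0}{x_{2k}}+a\,\sigma^*F^{(1)}_{2k+j},\qquad x_{ -k-j}=\frac{x_{k-j}x_0}{x_{2k}}+a\,\sigma^*F^{(1)}_{3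k+j}+a^2\,\sigma^*F^{(2)}_{3k+j}.$$
   Context: All $x_n$ produced by the recurrence are nonzero elements of $\mathbb{F}$, so the iteration is well defined. $\sigma^*$ denotes the field automorphism of $\mathbb{F}$ fixing $a$ and sending $x_j\mapsto x_{2k-j}$ for $0\le j\le 2k$. -}

module Defs where

open import Level using (Level; suc; _⊔_)
open import Algebra.Bundles using (CommutativeRing)
open import Relation.Nullary using (¬_)
open import Data.Nat using (ℕ; zero)
import Data.Nat as N

record Field (c ℓ : Level) : Set (suc (c ⊔ ℓ)) where
  field
    commutativeRing : CommutativeRing c ℓ
  open CommutativeRing commutativeRing public
  field
    _⁻¹      : Carrier → Carrier
    ⁻¹-cong  : ∀ {x y} → x ≈ y → (x ⁻¹) ≈ (y ⁻¹)
    inverseʳ : ∀ x → ¬ (x ≈ 0#) → (x * (x ⁻¹)) ≈ 1#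
    0≉1      : ¬ (0# ≈ 1#)

module FieldDefs {c ℓ : Level} (𝔽 : Field c ℓ) where
  open Field 𝔽 public

  infixl 7 _/_
  _/_ : Carrier → Carrier → Carrier
  x / y = x * (y ⁻¹)

  ℕ→F : ℕ → Carrier
  ℕ→F zero      = 0#
  ℕ→F (N.suc n) = 1# + ℕ→F n

  sum1 : (ℕ → Carrier) → ℕ → Carrier
  sum1 f zero      = 0#
  sum1 f (N.suc j) = sum1 f j + f (N.suc j)

  -- v n stands for x_n (only 0 ≤ n ≤ 2k is used)
  -- F1a k v j = F^{(1)}_{2k+j}
  F1a : ℕ → (ℕ → Carrier) → ℕ → Carrier
  F1a k v j = v j * sum1 (λ l → (v (k N.+ (l N.∸ 1)) + v (k N.+ l)) / (v (l N.∸ 1) * v l)) j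

  F1b : ℕ → (ℕ → Carrier) → ℕ → Carrier
  F1b k v j =
    ((v (k N.+ j) * v (2 N.* k)) / v 0)
      * sum1 (λ l → (v (l N.∸ 1) + v l) / (v (k N.+ (l N.∸ 1)) * v (k N.+ l))) j
    + (v (k N.+ j) / v k) * F1a k v k

  F2b : ℕ → (ℕ → Carrier) → ℕ → Carrier
  F2b k v j =
    v (k N.+ j) * sum1 (λ l → (F1a k v (l N.∸ 1) + F1a k v l) / (v (k N.+ (l N.∸ 1)) * v (k N.+ l))) j

  σ : ℕ → (ℕ → Carrier) → (ℕ → Carrier)
  σ k v j = v (2 N.* k N.∸ j)

-- Writing q n = x_{2k+n} / x_n, the recurrence at n says exactly that
-- q (n+1) = q n + a (x_{k+n} + x_{k+n+1}) / (x_n x_{n+1}), so q telescopes: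
-- q j = x_{2k}/x_0 + a Σ_{ℓ ≤ j} (...), which after multiplying by x_j is the
-- formula for x_{2k+j}.  Running the same telescope from n = k and inserting
-- the first formula for x_{2k+ℓ} = x_{k+(k+ℓ)} into its summands gives x_{3k+j}.
-- The recurrence is invariant under n ↦ 2k - n, which turns the forward formulas
-- for the reflected sequence into the backward ones; they only involve the
-- initial values x_0, …, x_{2k}, on which the reflected sequence is σ x.
module Submission where

open import Defs
open import Data.Nat using (ℕ; zero; suc; _≤_)
open import Data.Integer using (ℤ; +_)
import Data.Integer as Z
open import Data.Product using (_×_; _,_)
open import Relation.Nullary using (¬_)
import Data.Nat as N
import Data.Nat.Properties as NP
import Data.Integer.Properties as ZP
open import Relation.Binary.PropositionalEquality as P using (_≡_)
import Algebra.Properties.CommutativeSemigroup as CommutativeSemigroupProperties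
import Algebra.Solver.Ring.NaturalCoefficients.Default as RingSolver
import Relation.Binary.Reasoning.Setoid as SetoidReasoning
open import Data.Nat.Tactic.RingSolver using (solve-∀)
open import Data.Integer.Tactic.RingSolver as ℤ-Solver using ()

module FieldProperties {c ℓ} (𝔽 : Field c ℓ) where
  open FieldDefs 𝔽
  open SetoidReasoning setoid
  open CommutativeSemigroupProperties *-commutativeSemigroup using (x∙yz≈y∙xz)

  ⁻¹-cancelˡ : ∀ {y} x → ¬ (y ≈ 0#) → y ⁻¹ * (y * x) ≈ x
  ⁻¹-cancelˡ {y} x y≉0 = begin
    y ⁻¹ * (y * x) ≈⟨ x∙yz≈y∙xz (y ⁻¹) y x ⟩
    y * (y ⁻¹ * x) ≈⟨ *-assoc y (y ⁻¹) x ⟨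
    y * y ⁻¹ * x   ≈⟨ *-congʳ (inverseʳ y y≉0) ⟩
    1# * x         ≈⟨ *-identityˡ x ⟩
    x              ∎

  *-cancelˡ : ∀ {y u v} → ¬ (y ≈ 0#) → y * u ≈ y * v → u ≈ v
  *-cancelˡ {y} {u} {v} y≉0 yu≈yv = begin
    u              ≈⟨ ⁻¹-cancelˡ u y≉0 ⟨
    y ⁻¹ * (y * u) ≈⟨ *-congˡ yu≈yv ⟩
    y ⁻¹ * (y * v) ≈⟨ ⁻¹-cancelˡ v y≉0 ⟩
    v              ∎

  *-nonzero : ∀ {y z} → ¬ (y ≈ 0#) → ¬ (z ≈ 0#) → ¬ (y * z ≈ 0#)
  *-nonzero {y} y≉0 z≉0 yz≈0 = z≉0 (*-cancelˡ y≉0 (trans yz≈0 (sym (zeroʳ y))))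

  *-/-cancel : ∀ {y} x → ¬ (y ≈ 0#) → y * (x / y) ≈ x
  *-/-cancel {y} x y≉0 = begin
    y * (x * y ⁻¹) ≈⟨ x∙yz≈y∙xz y x (y ⁻¹) ⟩
    x * (y * y ⁻¹) ≈⟨ *-congˡ (inverseʳ y y≉0) ⟩
    x * 1#         ≈⟨ *-identityʳ x ⟩
    x              ∎

  [y*u+v]/y≈u+v/y : ∀ {y} u v → ¬ (y ≈ 0#) → (y * u + v) / y ≈ u + v / y
  [y*u+v]/y≈u+v/y {y} u v y≉0 = begin
    (y * u + v) * y ⁻¹         ≈⟨ distribʳ (y ⁻¹) (y * u) v ⟩
    y * u * y ⁻¹ + v * y ⁻¹    ≈⟨ +-congʳ (*-congʳ (*-comm y u)) ⟩
    u * y * y ⁻¹ + v * y ⁻¹    ≈⟨ +-congʳ (*-assoc u y (y ⁻¹)) ⟩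
    u * (y * y ⁻¹) + v * y ⁻¹  ≈⟨ +-congʳ (*-congˡ (inverseʳ y y≉0)) ⟩
    u * 1# + v * y ⁻¹          ≈⟨ +-congʳ (*-identityʳ u) ⟩
    u + v / y                  ∎

  cross-relation⇒quotients : ∀ {p q P Q b S} → ¬ (p ≈ 0#) → ¬ (q ≈ 0#) →
    P * p ≈ Q * q + b * S → P / q ≈ Q / p + b * (S / (p * q))
  cross-relation⇒quotients {p} {q} {P} {Q} {b} {S} p≉0 q≉0 relation =
    *-cancelˡ (*-nonzero p≉0 q≉0) (begin
      p * q * (P / q)                         ≈⟨ *-assoc p q (P / q) ⟩
      p * (q * (P / q))                       ≈⟨ *-congˡ (*-/-cancel P q≉0) ⟩
      p * P                                   ≈⟨ *-comm p P ⟩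
      P * p                                   ≈⟨ relation ⟩
      Q * q + b * S                           ≈⟨ +-cong (*-comm q Q) (*-congˡ (*-/-cancel S (*-nonzero p≉0 q≉0))) ⟨
      q * Q + b * (p * q * (S / (p * q)))     ≈⟨ +-cong (*-congˡ (*-/-cancel Q p≉0)) (x∙yz≈y∙xz (p * q) b T) ⟨
      q * (p * (Q / p)) + p * q * (b * T)     ≈⟨ +-congʳ (x∙yz≈y∙xz q p (Q / p)) ⟩
      p * (q * (Q / p)) + p * q * (b * T)     ≈⟨ +-congʳ (*-assoc p q (Q / p)) ⟨
      p * q * (Q / p) + p * q * (b * T)       ≈⟨ distribˡ (p * q) (Q / p) (b * T) ⟨
      p * q * (Q / p + b * T)                 ∎)
    where T = S / (p * q)

module Sum1Properties {c ℓ} (𝔽 : Field c ℓ) where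
  open FieldDefs 𝔽
  open SetoidReasoning setoid
  open CommutativeSemigroupProperties +-commutativeSemigroup using (interchange)

  sum1-cong : ∀ {f g} → (∀ l → f l ≈ g l) → ∀ j → sum1 f j ≈ sum1 g j
  sum1-cong f≈g zero      = refl
  sum1-cong f≈g (suc j)   = +-cong (sum1-cong f≈g j) (f≈g (suc j))

  sum1-+ : ∀ f g j → sum1 (λ l → f l + g l) j ≈ sum1 f j + sum1 g j
  sum1-+ f g zero      = sym (+-identityʳ 0#)
  sum1-+ f g (suc j)   = trans (+-congʳ (sum1-+ f g j)) (interchange _ _ _ _)

  sum1-*ˡ : ∀ y f j → sum1 (λ l → y * f l) j ≈ y * sum1 f j
  sum1-*ˡ y f zero      = sym (zeroʳ y)
  sum1-*ˡ y f (suc j)   = trans (+-congʳ (sum1-*ˡ y f j)) (sym (distribˡ y _ _))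

  sum1-telescope : ∀ {d e : ℕ → Carrier} → (∀ i → d (suc i) ≈ d i + e (suc i)) →
                   ∀ j → d j ≈ d 0 + sum1 e j
  sum1-telescope step zero = sym (+-identityʳ _)
  sum1-telescope {d} {e} step (suc j) = begin
    d (suc j)                   ≈⟨ step j ⟩
    d j + e (suc j)             ≈⟨ +-congʳ (sum1-telescope step j) ⟩
    d 0 + sum1 e j + e (suc j)  ≈⟨ +-assoc (d 0) (sum1 e j) (e (suc j)) ⟩
    d 0 + sum1 e (suc j)        ∎

≤k⇒≤2k : ∀ {k l} → l ≤ k → l ≤ 2 N.* k
≤k⇒≤2k l≤k = NP.≤-trans l≤k (NP.m≤m+n _ _)

≤k⇒k+≤2k : ∀ {k l} → l ≤ k → k N.+ l ≤ 2 N.* k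
≤k⇒k+≤2k {k} l≤k = NP.+-monoʳ-≤ k (NP.≤-trans l≤k (NP.m≤m+n k 0))

module Locality {c ℓ} (𝔽 : Field c ℓ) (k : ℕ) (w w′ : ℕ → Field.Carrier 𝔽)
                (agree : ∀ m → m ≤ 2 N.* k → w m ≡ w′ m) where
  open FieldDefs 𝔽

  private
    sum1-cong-≤ : ∀ {f g} j → (∀ l → l ≤ j → f l ≡ g l) → sum1 f j ≡ sum1 g j
    sum1-cong-≤ zero      f≡g = P.refl
    sum1-cong-≤ (suc j)   f≡g =
      P.cong₂ _+_ (sum1-cong-≤ j (λ l l≤j → f≡g l (NP.m≤n⇒m≤1+n l≤j))) (f≡g (suc j) NP.≤-refl)

    pred≤ : ∀ {l} → l ≤ k → l N.∸ 1 ≤ k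
    pred≤ {l} l≤k = NP.≤-trans (NP.m∸n≤m l 1) l≤k

  F1a-local : ∀ j → j ≤ k → F1a k w j ≡ F1a k w′ j
  F1a-local j j≤k = P.cong₂ _*_ (agree j (≤k⇒≤2k j≤k)) (sum1-cong-≤ j λ l l≤j →
    let l≤k = NP.≤-trans l≤j j≤k in
    P.cong₂ _/_ (P.cong₂ _+_ (agree _ (≤k⇒k+≤2k (pred≤ l≤k))) (agree _ (≤k⇒k+≤2k l≤k)))
                (P.cong₂ _*_ (agree _ (≤k⇒≤2k (pred≤ l≤k))) (agree _ (≤k⇒≤2k l≤k))))

  F1b-local : ∀ j → j ≤ k → F1b k w j ≡ F1b k w′ j
  F1b-local j j≤k = P.cong₂ _+_
    (P.cong₂ _*_
      (P.cong₂ _/_ (P.cong₂ _*_ (agree _ (≤k⇒k+≤2k j≤k)) (agree _ NP.≤-refl)) (agree 0 N.z≤n))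
      (sum1-cong-≤ j λ l l≤j →
        let l≤k = NP.≤-trans l≤j j≤k in
        P.cong₂ _/_ (P.cong₂ _+_ (agree _ (≤k⇒≤2k (pred≤ l≤k))) (agree _ (≤k⇒≤2k l≤k)))
                    (P.cong₂ _*_ (agree _ (≤k⇒k+≤2k (pred≤ l≤k))) (agree _ (≤k⇒k+≤2k l≤k)))))
    (P.cong₂ _*_ (P.cong₂ _/_ (agree _ (≤k⇒k+≤2k j≤k)) (agree _ (≤k⇒≤2k NP.≤-refl))) (F1a-local k NP.≤-refl))

  F2b-local : ∀ j → j ≤ k → F2b k w j ≡ F2b k w′ j
  F2b-local j j≤k = P.cong₂ _*_ (agree _ (≤k⇒k+≤2k j≤k)) (sum1-cong-≤ j λ l l≤j →
    let l≤k = NP.≤-trans l≤j j≤k in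
    P.cong₂ _/_ (P.cong₂ _+_ (F1a-local _ (pred≤ l≤k)) (F1a-local _ l≤k))
                (P.cong₂ _*_ (agree _ (≤k⇒k+≤2k (pred≤ l≤k))) (agree _ (≤k⇒k+≤2k l≤k))))

module Recurrence {c ℓ} (𝔽 : Field c ℓ) (k : ℕ) (a : Field.Carrier 𝔽) where
  open FieldDefs 𝔽
  open FieldProperties 𝔽
  open Sum1Properties 𝔽
  open RingSolver commutativeSemiring using (solve; _:=_; _:+_; _:*_)
  open SetoidReasoning setoid

  IsSolution : (ℤ → Carrier) → Set ℓ
  IsSolution x = ∀ n →
    x (n Z.+ + (2 N.* k N.+ 1)) * x n
      ≈ x (n Z.+ + (2 N.* k)) * x (n Z.+ + 1) + a * (x (n Z.+ + k) + x (n Z.+ + (k N.+ 1)))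

  IsNatSolution : (ℕ → Carrier) → Set ℓ
  IsNatSolution w = ∀ m →
    w (2 N.* k N.+ suc m) * w m
      ≈ w (2 N.* k N.+ m) * w (suc m) + a * (w (k N.+ m) + w (k N.+ suc m))

  private
    relation-reindex : ∀ {I : Set} (f : I → Carrier) {B} {i₁ i₃ i₄ i₅ i₆ j₁ j₃ j₄ j₅ j₆ : I} →
      i₁ ≡ j₁ → i₃ ≡ j₃ → i₄ ≡ j₄ → i₅ ≡ j₅ → i₆ ≡ j₆ →
      f i₁ * B ≈ f i₃ * f i₄ + a * (f i₅ + f i₆) → f j₁ * B ≈ f j₃ * f j₄ + a * (f j₅ + f j₆)
    relation-reindex f P.refl P.refl P.refl P.refl P.refl relation = relation

    relation-swap : ∀ {A B C D E G} → A * B ≈ C * D + a * (E + G) → B * A ≈ D * C + a * (G + E)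
    relation-swap relation = trans (*-comm _ _) (trans relation (+-cong (*-comm _ _) (*-congˡ (+-comm _ _))))

  isSolution-restrict : ∀ {x} → IsSolution x → IsNatSolution (λ m → x (+ m))
  isSolution-restrict {x} x-sol m = relation-reindex (λ i → x (+ i))
      (m+[2k+1]≡2k+sm k m) (NP.+-comm m _) (NP.+-comm m 1) (NP.+-comm m k) (m+[k+1]≡k+sm k m)
      (x-sol (+ m))
    where
    m+[2k+1]≡2k+sm : ∀ k m → m N.+ (2 N.* k N.+ 1) ≡ 2 N.* k N.+ suc m
    m+[2k+1]≡2k+sm = solve-∀
    m+[k+1]≡k+sm : ∀ k m → m N.+ (k N.+ 1) ≡ k N.+ suc m
    m+[k+1]≡k+sm = solve-∀

  -- Evaluating the recurrence at m = c - (n + 2k + 1) relates the same six terms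
  -- of the reflected sequence, with the two products read backwards.
  isSolution-reflect : ∀ {x} → IsSolution x → ∀ c → IsSolution (λ n → x (c Z.- n))
  isSolution-reflect {x} x-sol c n = relation-swap (relation-reindex x
      (shift-2k+1 (+ k) c n) (shift-2k (+ k) c n) (shift-1 (+ k) c n)
      (shift-k (+ k) c n) (shift-k+1 (+ k) c n)
      (x-sol (c Z.- (n Z.+ + (2 N.* k N.+ 1)))))
    where
    open ℤ-Solver using () renaming (solve-∀ to ℤ-solve-∀)
    -- Stated over K = + k, where + (2 N.* k) unfolds definitionally to K + (K + + 0).
    shift-2k+1 : ∀ K c n → let 2K = K Z.+ (K Z.+ + 0) in
      (c Z.- (n Z.+ (2K Z.+ + 1))) Z.+ (2K Z.+ + 1) ≡ c Z.- n
    shift-2k+1 = ℤ-solve-∀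
    shift-2k : ∀ K c n → let 2K = K Z.+ (K Z.+ + 0) in
      (c Z.- (n Z.+ (2K Z.+ + 1))) Z.+ 2K ≡ c Z.- (n Z.+ + 1)
    shift-2k = ℤ-solve-∀
    shift-1 : ∀ K c n → let 2K = K Z.+ (K Z.+ + 0) in
      (c Z.- (n Z.+ (2K Z.+ + 1))) Z.+ + 1 ≡ c Z.- (n Z.+ 2K)
    shift-1 = ℤ-solve-∀
    shift-k : ∀ K c n → let 2K = K Z.+ (K Z.+ + 0) in
      (c Z.- (n Z.+ (2K Z.+ + 1))) Z.+ K ≡ c Z.- (n Z.+ (K Z.+ + 1))
    shift-k = ℤ-solve-∀
    shift-k+1 : ∀ K c n → let 2K = K Z.+ (K Z.+ + 0) in
      (c Z.- (n Z.+ (2K Z.+ + 1))) Z.+ (K Z.+ + 1) ≡ c Z.- (n Z.+ K)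
    shift-k+1 = ℤ-solve-∀

  module Blocks (w : ℕ → Carrier) (w≉0 : ∀ m → ¬ (w m ≈ 0#)) (w-sol : IsNatSolution w) where

    quotient : ℕ → Carrier
    quotient n = w (2 N.* k N.+ n) / w n

    increment : ℕ → ℕ → Carrier
    increment p n = (w (k N.+ p) + w (k N.+ n)) / (w p * w n)

    quotient-step : ∀ p n → n ≡ suc p → quotient n ≈ quotient p + a * increment p n
    quotient-step p _ P.refl = cross-relation⇒quotients (w≉0 p) (w≉0 (suc p)) (w-sol p)

    quotient-telescope : ∀ s j →
      quotient (s N.+ j) ≈ quotient (s N.+ 0) + a * sum1 (λ l → increment (s N.+ (l N.∸ 1)) (s N.+ l)) j
    quotient-telescope s j =
      trans (sum1-telescope (λ i → quotient-step (s N.+ i) _ (NP.+-suc s i)) j)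
            (+-congˡ (sum1-*ˡ a _ j))

    first-block : ∀ j → w (2 N.* k N.+ j) ≈ (w j * w (2 N.* k)) / w 0 + a * F1a k w j
    first-block j = begin
      w (2 N.* k N.+ j)                  ≈⟨ *-/-cancel _ (w≉0 j) ⟨
      w j * quotient j                   ≈⟨ *-congˡ (quotient-telescope 0 j) ⟩
      w j * (quotient 0 + a * Σ)         ≈⟨ *-congˡ (+-congʳ (reflexive (P.cong (λ i → w i / w 0) (NP.+-identityʳ _)))) ⟩
      w j * (w (2 N.* k) / w 0 + a * Σ)  ≈⟨ solve 5 (λ y W i b S → y :* (W :* i :+ b :* S) := y :* W :* i :+ b :* (y :* S))
                                              refl (w j) (w (2 N.* k)) (w 0 ⁻¹) a Σ ⟩
      (w j * w (2 N.* k)) / w 0 + a * F1a k w j ∎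
      where Σ = sum1 (λ l → increment (l N.∸ 1) l) j

    -- Since x_{k+(k+t)} = x_{2k+t}, the first formula applies to the numerators.
    second-increment : ∀ l → increment (k N.+ (l N.∸ 1)) (k N.+ l)
      ≈ (w (2 N.* k) / w 0) * ((w (l N.∸ 1) + w l) / (w (k N.+ (l N.∸ 1)) * w (k N.+ l)))
        + a * ((F1a k w (l N.∸ 1) + F1a k w l) / (w (k N.+ (l N.∸ 1)) * w (k N.+ l)))
    second-increment l = begin
      (w (k N.+ (k N.+ (l N.∸ 1))) + w (k N.+ (k N.+ l))) * D
        ≈⟨ *-congʳ (+-cong (first-block-shifted (l N.∸ 1)) (first-block-shifted l)) ⟩
      ((w (l N.∸ 1) * W) * i + a * F1a k w (l N.∸ 1) + ((w l * W) * i + a * F1a k w l)) * D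
        ≈⟨ solve 8 (λ u v W i b Fu Fv D →
               (u :* W :* i :+ b :* Fu :+ (v :* W :* i :+ b :* Fv)) :* D
                 := W :* i :* ((u :+ v) :* D) :+ b :* ((Fu :+ Fv) :* D))
             refl (w (l N.∸ 1)) (w l) W i a (F1a k w (l N.∸ 1)) (F1a k w l) D ⟩
      (W / w 0) * ((w (l N.∸ 1) + w l) * D) + a * ((F1a k w (l N.∸ 1) + F1a k w l) * D) ∎
      where
      W = w (2 N.* k)
      i = w 0 ⁻¹
      D = (w (k N.+ (l N.∸ 1)) * w (k N.+ l)) ⁻¹
      first-block-shifted : ∀ t → w (k N.+ (k N.+ t)) ≈ (w t * W) / w 0 + a * F1a k w t
      first-block-shifted t = trans (reflexive (P.cong w (k+[k+t]≡2k+t k t))) (first-block t)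
        where
        k+[k+t]≡2k+t : ∀ k t → k N.+ (k N.+ t) ≡ 2 N.* k N.+ t
        k+[k+t]≡2k+t = solve-∀

    second-block : ∀ j → w (3 N.* k N.+ j)
      ≈ (w (k N.+ j) * w (2 N.* k)) / w 0 + a * F1b k w j + (a * a) * F2b k w j
    second-block j = begin
      w (3 N.* k N.+ j)
        ≈⟨ reflexive (P.cong w (3k+j≡2k+[k+j] k j)) ⟩
      w (2 N.* k N.+ (k N.+ j))
        ≈⟨ *-/-cancel _ (w≉0 (k N.+ j)) ⟨
      y * quotient (k N.+ j)
        ≈⟨ *-congˡ (quotient-telescope k j) ⟩
      y * (quotient (k N.+ 0) + a * sum1 (λ l → increment (k N.+ (l N.∸ 1)) (k N.+ l)) j)
        ≈⟨ *-congˡ (+-cong (reflexive (P.cong quotient (NP.+-identityʳ k)))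
                           (*-congˡ (trans (sum1-cong second-increment j)
                                           (trans (sum1-+ _ _ j) (+-cong (sum1-*ˡ _ _ j) (sum1-*ˡ a _ j)))))) ⟩
      y * (quotient k + a * ((W / w 0) * Σ₁ + a * Σ₂))
        ≈⟨ *-congˡ (+-congʳ quotient-k) ⟩
      y * (W / w 0 + F / w k + a * ((W / w 0) * Σ₁ + a * Σ₂))
        ≈⟨ solve 8 (λ y W i ik b F S₁ S₂ →
               y :* (W :* i :+ b :* F :* ik :+ b :* (W :* i :* S₁ :+ b :* S₂))
                 := y :* W :* i :+ b :* (y :* W :* i :* S₁ :+ y :* ik :* F) :+ b :* b :* (y :* S₂))
             refl y W (w 0 ⁻¹) (w k ⁻¹) a (F1a k w k) Σ₁ Σ₂ ⟩
      (y * W) / w 0 + a * F1b k w j + (a * a) * F2b k w j ∎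
      where
      y = w (k N.+ j)
      W = w (2 N.* k)
      F = a * F1a k w k
      Σ₁ = sum1 (λ l → (w (l N.∸ 1) + w l) / (w (k N.+ (l N.∸ 1)) * w (k N.+ l))) j
      Σ₂ = sum1 (λ l → (F1a k w (l N.∸ 1) + F1a k w l) / (w (k N.+ (l N.∸ 1)) * w (k N.+ l))) j
      3k+j≡2k+[k+j] : ∀ k j → 3 N.* k N.+ j ≡ 2 N.* k N.+ (k N.+ j)
      3k+j≡2k+[k+j] = solve-∀
      quotient-k : quotient k ≈ W / w 0 + F / w k
      quotient-k = begin
        w (2 N.* k N.+ k) / w k     ≈⟨ *-congʳ (first-block k) ⟩
        ((w k * W) / w 0 + F) / w k ≈⟨ *-congʳ (+-congʳ (*-assoc (w k) W (w 0 ⁻¹))) ⟩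
        (w k * (W / w 0) + F) / w k ≈⟨ [y*u+v]/y≈u+v/y (W / w 0) F (w≉0 k) ⟩
        W / w 0 + F / w k           ∎

  module _ {x : ℤ → Carrier} (x≉0 : ∀ n → ¬ (x n ≈ 0#)) (x-sol : IsSolution x) where
    private
      v : ℕ → Carrier
      v m = x (+ m)

      reflected : ℕ → Carrier
      reflected m = x (+ (2 N.* k) Z.- + m)

      open Blocks reflected (λ m → x≉0 _) (isSolution-restrict (isSolution-reflect x-sol (+ (2 N.* k))))
      open ℤ-Solver using () renaming (solve-∀ to ℤ-solve-∀)

      reflected≡σv : ∀ m → m ≤ 2 N.* k → reflected m ≡ σ k v m
      reflected≡σv m m≤2k = P.cong x (P.trans (ZP.m-n≡m⊖n _ m) (ZP.⊖-≥ m≤2k))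

      open Locality 𝔽 k reflected (σ k v) reflected≡σv

      reflected-2k : reflected (2 N.* k) ≡ v 0
      reflected-2k = P.trans (reflected≡σv _ NP.≤-refl) (P.cong v (NP.n∸n≡0 (2 N.* k)))

      2k-[2k+j]≡-j : ∀ K J → let 2K = K Z.+ (K Z.+ + 0) in 2K Z.- (2K Z.+ J) ≡ Z.- J
      2k-[2k+j]≡-j = ℤ-solve-∀

      2k-[3k+j]≡-[k+j] : ∀ K J → let 2K = K Z.+ (K Z.+ + 0) in 2K Z.- ((K Z.+ 2K) Z.+ J) ≡ Z.- (K Z.+ J)
      2k-[3k+j]≡-[k+j] = ℤ-solve-∀

    backward-first-block : ∀ j → j ≤ k →
      x (Z.- (+ j)) ≈ (v (2 N.* k N.∸ j) * v 0) / v (2 N.* k) + a * F1a k (σ k v) j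
    backward-first-block j j≤k = begin
      x (Z.- (+ j))                  ≡⟨ P.cong x (2k-[2k+j]≡-j (+ k) (+ j)) ⟨
      reflected (2 N.* k N.+ j)      ≈⟨ first-block j ⟩
      (reflected j * reflected (2 N.* k)) / reflected 0 + a * F1a k reflected j
        ≡⟨ P.cong₂ (λ A B → A + a * B)
             (P.cong₂ _/_ (P.cong₂ _*_ (reflected≡σv j (≤k⇒≤2k j≤k)) reflected-2k) (reflected≡σv 0 N.z≤n))
             (F1a-local j j≤k) ⟩
      (v (2 N.* k N.∸ j) * v 0) / v (2 N.* k) + a * F1a k (σ k v) j ∎

    backward-second-block : ∀ j → j ≤ k →
      x (Z.- (+ (k N.+ j)))
        ≈ (v (k N.∸ j) * v 0) / v (2 N.* k) + a * F1b k (σ k v) j + (a * a) * F2b k (σ k v) j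
    backward-second-block j j≤k = begin
      x (Z.- (+ (k N.+ j)))          ≡⟨ P.cong x (2k-[3k+j]≡-[k+j] (+ k) (+ j)) ⟨
      reflected (3 N.* k N.+ j)      ≈⟨ second-block j ⟩
      (reflected (k N.+ j) * reflected (2 N.* k)) / reflected 0 + a * F1b k reflected j + (a * a) * F2b k reflected j
        ≡⟨ P.cong₂ _+_
             (P.cong₂ (λ A B → A + a * B)
               (P.cong₂ _/_ (P.cong₂ _*_ reflected-k+j reflected-2k) (reflected≡σv 0 N.z≤n))
               (F1b-local j j≤k))
             (P.cong ((a * a) *_) (F2b-local j j≤k)) ⟩
      (v (k N.∸ j) * v 0) / v (2 N.* k) + a * F1b k (σ k v) j + (a * a) * F2b k (σ k v) j ∎
      where
      reflected-k+j : reflected (k N.+ j) ≡ v (k N.∸ j)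
      reflected-k+j = P.trans (reflected≡σv _ (≤k⇒k+≤2k j≤k))
        (P.cong v (P.trans (NP.[m+n]∸[m+o]≡n∸o k (k N.+ 0) j) (P.cong (N._∸ j) (NP.+-identityʳ k))))

lemma2p7 : ∀ {c ℓ} (𝔽 : Field c ℓ) → let open FieldDefs 𝔽 in
    (∀ n → ¬ (ℕ→F (N.suc n) ≈ 0#)) →
    (k : ℕ) → 1 ≤ k → (a : Carrier) (x : ℤ → Carrier) →
    (∀ n → ¬ (x n ≈ 0#)) →
    (∀ n → (x (n Z.+ + (2 N.* k N.+ 1)) * x n)
             ≈ (x (n Z.+ + (2 N.* k)) * x (n Z.+ + 1) + a * (x (n Z.+ + k) + x (n Z.+ + (k N.+ 1))))) →
    ∀ j → 1 ≤ j → j ≤ k →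
      let v = λ (m : ℕ) → x (+ m) in
      (x (+ (2 N.* k N.+ j)) ≈ (v j * v (2 N.* k)) / v 0 + a * F1a k v j)
      × (x (+ (3 N.* k N.+ j)) ≈ (v (k N.+ j) * v (2 N.* k)) / v 0 + a * F1b k v j + (a * a) * F2b k v j)
      × (x (Z.- (+ j)) ≈ (v (2 N.* k N.∸ j) * v 0) / v (2 N.* k) + a * F1a k (σ k v) j)
      × (x (Z.- (+ (k N.+ j))) ≈ (v (k N.∸ j) * v 0) / v (2 N.* k) + a * F1b k (σ k v) j + (a * a) * F2b k (σ k v) j)
lemma2p7 𝔽 _ k _ a x x≉0 x-sol j _ j≤k =
    first-block j , second-block j , backward-first-block x≉0 x-sol j j≤k , backward-second-block x≉0 x-sol j j≤k
  where
  open Recurrence 𝔽 k a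
  open Blocks (λ m → x (+ m)) (λ m → x≉0 (+ m)) (isSolution-restrict x-sol)
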